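{- Let $G$ be a commutative group, $G'$ a subgroup of $G$, and $U\subset G'$ a finite set. Then $\beta(U,G)=\beta(U,G')$.
   Context: For a finite set $U$ in a commutative group $K$, $\beta(U,K)=\inf_{A,B}\frac{|A+B+U|}{|A|^{1/2}|B|^{1/2}}$, where the infimum is over all finite nonempty $A,B\subset K$ and $A+B+U=\{a+b+u\}$. -}

module Defs where

open import Level using (Level; _⊔_)
open import Algebra.Bundles using (AbelianGroup)
open import Data.Nat using (ℕ; _*_; _<_)
open import Data.List using (List; []; length)
open import Data.List.Relation.Unary.All using (All)
open import Data.List.Relation.Unary.Any using (Any)
open import Data.List.Relation.Unary.AllPairs using (AllPairs)
open import Data.Product using (Σ; ∃; _×_; _,_)
open import Function.Bundles using (_⇔_)
open import Relation.Nullary using (¬_)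

module _ {c ℓ : Level} (G : AbelianGroup c ℓ) where
  open AbelianGroup G

  _∈≈_ : Carrier → List Carrier → Set (c ⊔ ℓ)
  x ∈≈ xs = Any (x ≈_) xs

  -- a list without repetitions (up to ≈): a finite set, its length is its cardinality
  Distinct : List Carrier → Set (c ⊔ ℓ)
  Distinct = AllPairs (λ x y → ¬ (x ≈ y))

  NonEmpty : List Carrier → Set c
  NonEmpty xs = ¬ (xs ≡L [])
    where
    open import Relation.Binary.PropositionalEquality using () renaming (_≡_ to _≡L_)

  IsSumset : List Carrier → List Carrier → List Carrier → List Carrier → Set (c ⊔ ℓ)
  IsSumset A B U C =
    Distinct C ×
    (∀ x → (x ∈≈ C) ⇔ (∃ λ a → ∃ λ b → ∃ λ u →
       (a ∈≈ A) × (b ∈≈ B) × (u ∈≈ U) × (x ≈ (a ∙ b) ∙ u)))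

  record IsSubgroup {p : Level} (P : Carrier → Set p) : Set (c ⊔ ℓ ⊔ p) where
    field
      resp  : ∀ {x y} → x ≈ y → P x → P y
      ε-mem : P ε
      ∙-mem : ∀ {x y} → P x → P y → P (x ∙ y)
      ⁻¹-mem : ∀ {x} → P x → P (x ⁻¹)

  -- βBelow G H U m n  encodes  β(U,H) < m/n  (for n ≥ 1), where H ⊆ G is given
  -- by the predicate S: there exist finite nonempty A,B ⊆ H with
  --   |A+B+U| / (|A|^{1/2}|B|^{1/2}) < m/n,
  -- i.e. (squaring, all quantities ≥ 0)  n²·|A+B+U|² < m²·|A|·|B|.
  βBelow : {p : Level} (S : Carrier → Set p) → List Carrier → ℕ → ℕ → Set (c ⊔ ℓ ⊔ p)
  βBelow S U m n =
    ∃ λ A → ∃ λ B → ∃ λ C →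
      All S A × All S B × Distinct A × Distinct B ×
      NonEmpty A × NonEmpty B × IsSumset A B U C ×
      (n * n * (length C * length C) < m * m * (length A * length B))

{-# OPTIONS --safe #-}
-- Cut A and B into their classes A_c, B_d modulo H.  Sums from one class of A and two different
-- classes of B lie in different cosets, so along each row (and column) of the table of class pairs
-- the sumsets A_c + B_d + U are disjoint and their sizes add up to at most |A + B + U|.  If no pair
-- of classes did better than (A, B), the row of the largest A-class and the column of the largest
-- B-class would together force |A + B + U| ≥ β √(|A| |B|).  So some pair of classes does better,
-- and translating it into H gives the witness there.
-- Membership in H is not decidable, so the classes are not the cosets themselves: starting from
-- singletons, two classes are merged whenever a collision in the addition table puts them into one
-- coset, until the classes are closed under collisions.
module Submission where

open import Defs
open import Level using (Level; 0ℓ; _⊔_)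
open import Algebra.Bundles using (AbelianGroup)
open import Data.Nat using (ℕ; suc)
open import Data.List using (List)
open import Data.List.Relation.Unary.All using (All)
open import Data.Unit.Polymorphic using (⊤)
open import Function.Bundles using (_⇔_)

open import Data.Nat
  using (zero; _+_; _*_; _≤_; _<_; _≤?_; _<?_; z≤n; z<s; s≤s; s≤s⁻¹; NonZero; >-nonZero; >-nonZero⁻¹)
open import Data.Nat.Properties
  using ( ≤-refl; ≤-reflexive; ≤-trans; <-≤-trans; ≤-<-trans; <⇒≤; ≰⇒>; ≮⇒≥; <⇒≱; ≤⇒≯; m≤n+m
        ; +-mono-≤; +-mono-<-≤; +-mono-≤-<; +-monoʳ-<; +-monoˡ-<
        ; *-mono-≤; *-mono-<; *-monoʳ-≤; *-monoˡ-≤; *-comm; *-cancelʳ-≤; m*n≢0⇒m≢0; m*n≢0⇒n≢0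
        ; +-*-semiring; module ≤-Reasoning)
open import Data.Nat.Tactic.RingSolver using (solve-∀)
open import Algebra.Properties.Semiring.Sum +-*-semiring using (sum; sum-syntax; ∑-comm; *-distribˡ-sum)
open import Data.Fin using (Fin; zero; suc; toℕ; _≟_)
open import Data.Fin.Properties using (suc-injective; 0≢1+n; <-cmp; any?)
open import Data.Product using (∃; ∃₂; _×_; _,_; proj₁; proj₂)
open import Data.Sum using (_⊎_; inj₁; inj₂)
open import Data.List using (_∷_; length; lookup; map; filter; allFin; tabulate)
open import Data.List.Properties using (length-map)
open import Data.List.Relation.Unary.Any as Any using (Any)
import Data.List.Relation.Unary.Any.Properties as AnyP
import Data.List.Relation.Unary.All as All
import Data.List.Relation.Unary.All.Properties as AllP
open import Data.List.Relation.Unary.AllPairs using (_∷_)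
open import Data.List.Relation.Unary.Unique.Setoid using (Unique)
import Data.List.Relation.Unary.Unique.Setoid.Properties as UniqueS
open import Data.List.Relation.Unary.Unique.Propositional.Properties using (allFin⁺)
open import Data.List.Membership.Propositional using (lose; find)
open import Data.List.Membership.Propositional.Properties using (∈-filter⁺; ∈-filter⁻; ∈-allFin; ∈-lookup)
import Data.List.Membership.Setoid.Properties as ∈S
open import Function using (_∘_; id; flip)
open import Function.Bundles using (Equivalence; mk⇔)
open import Relation.Nullary using (Dec; yes; no; ¬_; contradiction)
open import Relation.Nullary.Decidable using (_×-dec_; ¬?; decidable-stable)
open import Relation.Unary using (Pred; Decidable)
open import Relation.Binary using (Rel; IsEquivalence; Setoid; tri<; tri≈; tri>)
import Relation.Binary.Construct.On as On
open import Relation.Binary.PropositionalEquality as ≡ using (_≡_; _≢_)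

∑-mono-≤ : ∀ {k} {f g : Fin k → ℕ} → (∀ i → f i ≤ g i) → sum f ≤ sum g
∑-mono-≤ {zero}  f≤g = z≤n
∑-mono-≤ {suc k} f≤g = +-mono-≤ (f≤g zero) (∑-mono-≤ (f≤g ∘ suc))

∑-mono-< : ∀ {k} {f g : Fin k → ℕ} → (∀ i → f i ≤ g i) → ∀ j → f j < g j → sum f < sum g
∑-mono-< {suc k} f≤g zero    fj<gj = +-mono-<-≤ fj<gj (∑-mono-≤ (f≤g ∘ suc))
∑-mono-< {suc k} f≤g (suc j) fj<gj = +-mono-≤-< (f≤g zero) (∑-mono-< (f≤g ∘ suc) j fj<gj)

∑-ones : ∀ k → ∑[ i < k ] 1 ≡ k
∑-ones zero    = ≡.refl
∑-ones (suc k) = ≡.cong suc (∑-ones k)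

0<∑⇒0<term : ∀ {k} (f : Fin k → ℕ) → 0 < sum f → ∃ λ i → 0 < f i
0<∑⇒0<term {suc k} f pos with f zero in f₀≡
... | suc _ = zero , ≡.subst (0 <_) (≡.sym f₀≡) z<s
... | zero  with i , 0<fi ← 0<∑⇒0<term (f ∘ suc) pos = suc i , 0<fi

argmax : ∀ {k} → Fin k → (f : Fin k → ℕ) → ∃ λ i → ∀ j → f j ≤ f i
argmax {suc zero}    _ f = zero , λ { zero → ≤-refl }
argmax {suc (suc k)} _ f with i , max ← argmax zero (f ∘ suc) | f zero ≤? f (suc i)
... | yes f₀≤ = suc i , λ { zero → f₀≤ ; (suc j) → max j }
... | no  f₀≰ = zero  , λ { zero → ≤-refl ; (suc j) → ≤-trans (max j) (<⇒≤ (≰⇒> f₀≰)) }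

positive-argmax : ∀ {k} (f : Fin k → ℕ) → 0 < sum f → ∃ λ i → 0 < f i × ∀ j → f j ≤ f i
positive-argmax f 0<∑f with i , 0<fi ← 0<∑⇒0<term f 0<∑f with i* , max ← argmax i f =
  i* , <-≤-trans 0<fi (max i) , max

m*m≤n*n⇒m≤n : ∀ {m n} → m * m ≤ n * n → m ≤ n
m*m≤n*n⇒m≤n m²≤n² = ≮⇒≥ λ n<m → <⇒≱ (*-mono-< n<m n<m) m²≤n²

positive-factors : ∀ a {x y} → 0 < a * (x * y) → 0 < x × 0 < y
positive-factors a {x} {y} pos =
  >-nonZero⁻¹ x {{m*n≢0⇒m≢0 x}} , >-nonZero⁻¹ y {{m*n≢0⇒n≢0 x}}
  where
  instance
    xy≢0 : NonZero (x * y)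
    xy≢0 = m*n≢0⇒n≢0 a {{>-nonZero pos}}

-- Read with square roots: Y √q ≤ X √p and y √q ≤ x √p add up.  The cross
-- terms compare because (Y y q)² = (Y² q)(y² q) ≤ (X² p)(x² p) = (X x p)².
scaled-square-+-mono : ∀ {X Y x y p q} → Y * Y * q ≤ X * X * p → y * y * q ≤ x * x * p →
                       (Y + y) * (Y + y) * q ≤ (X + x) * (X + x) * p
scaled-square-+-mono {X} {Y} {x} {y} {p} {q} Y≤X y≤x = begin
  (Y + y) * (Y + y) * q                   ≡⟨ expand Y y q ⟩
  Y * Y * q + 2 * (Y * y * q) + y * y * q ≤⟨ +-mono-≤ (+-mono-≤ Y≤X (*-monoʳ-≤ 2 cross≤)) y≤x ⟩
  X * X * p + 2 * (X * x * p) + x * x * p ≡⟨ expand X x p ⟨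
  (X + x) * (X + x) * p                   ∎
  where
  open ≤-Reasoning
  expand : ∀ a b c → (a + b) * (a + b) * c ≡ a * a * c + 2 * (a * b * c) + b * b * c
  expand = solve-∀
  regroup : ∀ a b c → (a * b * c) * (a * b * c) ≡ (a * a * c) * (b * b * c)
  regroup = solve-∀
  cross≤ : Y * y * q ≤ X * x * p
  cross≤ = m*m≤n*n⇒m≤n
    (≡.subst₂ _≤_ (≡.sym (regroup Y y q)) (≡.sym (regroup X x p)) (*-mono-≤ Y≤X y≤x))

scaled-square-∑-mono : ∀ {k} (f g : Fin k → ℕ) {p q} → (∀ i → g i * g i * q ≤ f i * f i * p) →
                       sum g * sum g * q ≤ sum f * sum f * p
scaled-square-∑-mono {zero}  f g g≤f = z≤n
scaled-square-∑-mono {suc k} f g g≤f =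
  scaled-square-+-mono {f zero} {g zero} {sum (f ∘ suc)} {sum (g ∘ suc)}
    (g≤f zero) (scaled-square-∑-mono (f ∘ suc) (g ∘ suc) (g≤f ∘ suc))

module _ (m n N : ℕ) where

  row-bound : ∀ {s} (a b* : ℕ) (b S : Fin s → ℕ) → (∀ d → b d ≤ b*) → sum S ≤ N →
              (∀ d → m * m * (a * b d) ≤ n * n * (S d * S d)) →
              (m * sum b) * (m * sum b) * a ≤ (n * N) * (n * N) * b*
  row-bound a b* b S b≤b* ∑S≤N cell = begin
    (m * sum b) * (m * sum b) * a     ≡⟨ ≡.cong (λ z → z * z * a) (*-distribˡ-sum m b) ⟩
    sum mb * sum mb * a               ≤⟨ scaled-square-∑-mono nS mb per-cell ⟩
    sum nS * sum nS * b*              ≡⟨ ≡.cong (λ z → z * z * b*) (*-distribˡ-sum n S) ⟨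
    (n * sum S) * (n * sum S) * b*    ≤⟨ *-monoˡ-≤ b* (*-mono-≤ n∑S≤nN n∑S≤nN) ⟩
    (n * N) * (n * N) * b*            ∎
    where
    open ≤-Reasoning
    mb nS : Fin _ → ℕ
    mb d = m * b d
    nS d = n * S d
    n∑S≤nN : n * sum S ≤ n * N
    n∑S≤nN = *-monoʳ-≤ n ∑S≤N
    regroupˡ : ∀ m x z → (m * x) * (m * x) * z ≡ m * m * (z * x) * x
    regroupˡ = solve-∀
    regroupʳ : ∀ n x y → n * n * (x * x) * y ≡ (n * x) * (n * x) * y
    regroupʳ = solve-∀
    per-cell : ∀ d → mb d * mb d * a ≤ nS d * nS d * b*
    per-cell d = begin
      mb d * mb d * a                ≡⟨ regroupˡ m (b d) a ⟩
      m * m * (a * b d) * b d        ≤⟨ *-monoʳ-≤ (m * m * (a * b d)) (b≤b* d) ⟩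
      m * m * (a * b d) * b*         ≤⟨ *-monoˡ-≤ b* (cell d) ⟩
      n * n * (S d * S d) * b*       ≡⟨ regroupʳ n (S d) b* ⟩
      nS d * nS d * b*               ∎

  -- Row c* of the largest a-value and column d* of the largest b-value give
  --   (m Σb)² a* ≤ (n N)² b*   and   (m Σa)² b* ≤ (n N)² a*,
  -- whose product is the claim squared, times a* b*.
  grid-bound : ∀ {r s} (a : Fin r → ℕ) (b : Fin s → ℕ) (S : Fin r → Fin s → ℕ) →
               (∀ c → ∑[ d < s ] S c d ≤ N) → (∀ d → ∑[ c < r ] S c d ≤ N) →
               (∀ c d → m * m * (a c * b d) ≤ n * n * (S c d * S c d)) →
               m * m * (sum a * sum b) ≤ n * n * (N * N)
  grid-bound a b S rows≤N columns≤N cell = ≮⇒≥ λ below → <⇒≱ below (bound below)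
    where
    bound : n * n * (N * N) < m * m * (sum a * sum b) → m * m * (sum a * sum b) ≤ n * n * (N * N)
    bound below
      with 0<∑a , 0<∑b ← positive-factors (m * m) (≤-<-trans z≤n below)
      with c* , 0<a* , a≤a* ← positive-argmax a 0<∑a
      with d* , 0<b* , b≤b* ← positive-argmax b 0<∑b
      = m*m≤n*n⇒m≤n (*-cancelʳ-≤ _ _ (a c* * b d*) {{>-nonZero (*-mono-< 0<a* 0<b*)}} product)
      where
      row : (m * sum b) * (m * sum b) * a c* ≤ (n * N) * (n * N) * b d*
      row = row-bound (a c*) (b d*) b (S c*) b≤b* (rows≤N c*) (cell c*)
      column : (m * sum a) * (m * sum a) * b d* ≤ (n * N) * (n * N) * a c*
      column = row-bound (b d*) (a c*) a (λ c → S c d*) a≤a* (columns≤N d*)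
                 λ c → ≡.subst (λ z → m * m * z ≤ n * n * (S c d* * S c d*)) (*-comm (a c) (b d*))
                                (cell c d*)
      regroupˡ : ∀ m x y u v → (m * x) * (m * x) * u * ((m * y) * (m * y) * v)
                             ≡ (m * m * (y * x)) * (m * m * (y * x)) * (u * v)
      regroupˡ = solve-∀
      regroupʳ : ∀ n N u v → (n * N) * (n * N) * u * ((n * N) * (n * N) * v)
                           ≡ (n * n * (N * N)) * (n * n * (N * N)) * (v * u)
      regroupʳ = solve-∀
      product : (m * m * (sum a * sum b)) * (m * m * (sum a * sum b)) * (a c* * b d*)
              ≤ (n * n * (N * N)) * (n * n * (N * N)) * (a c* * b d*)
      product = ≡.subst₂ _≤_ (regroupˡ m (sum b) (sum a) (a c*) (b d*)) (regroupʳ n N (b d*) (a c*))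
        (*-mono-≤ row column)

indicator : ∀ {a} {A : Set a} → Dec A → ℕ
indicator (yes _) = 1
indicator (no  _) = 0

count : ∀ {k p} {P : Pred (Fin k) p} → Decidable P → ℕ
count P? = ∑[ i < _ ] indicator (P? i)

module _ {p : Level} where

  0<count⇒∃ : ∀ {k} {P : Pred (Fin k) p} (P? : Decidable P) → 0 < count P? → ∃ P
  0<count⇒∃ P? pos with i , _ ← 0<∑⇒0<term (indicator ∘ P?) pos | P? i
  ... | yes Pi = i , Pi

  ∃⇒0<count : ∀ {k} {P : Pred (Fin k) p} (P? : Decidable P) → ∀ {i} → P i → 0 < count P?
  ∃⇒0<count P? {zero} P₀ with P? zero
  ... | yes _  = s≤s z≤n
  ... | no ¬P₀ = contradiction P₀ ¬P₀
  ∃⇒0<count P? {suc i} Pi = <-≤-trans (∃⇒0<count (P? ∘ suc) Pi) (m≤n+m _ (indicator (P? zero)))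

  ∄⇒count≡0 : ∀ {k} {P : Pred (Fin k) p} (P? : Decidable P) → (∀ i → ¬ P i) → count P? ≡ 0
  ∄⇒count≡0 {zero}  P? ¬P = ≡.refl
  ∄⇒count≡0 {suc k} P? ¬P with P? zero
  ... | yes P₀ = contradiction P₀ (¬P zero)
  ... | no  _  = ∄⇒count≡0 (P? ∘ suc) (¬P ∘ suc)

  unique⇒count≤1 : ∀ {k} {P : Pred (Fin k) p} (P? : Decidable P) →
                   (∀ {i j} → P i → P j → i ≡ j) → count P? ≤ 1
  unique⇒count≤1 {zero}  P? unique = z≤n
  unique⇒count≤1 {suc k} P? unique with P? zero
  ... | yes P₀ = ≤-reflexive (≡.cong suc (∄⇒count≡0 (P? ∘ suc) λ i Pi → 0≢1+n (unique P₀ Pi)))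
  ... | no  _  = unique⇒count≤1 (P? ∘ suc) λ Pi Pj → suc-injective (unique Pi Pj)

  module _ {s N} {X : Fin s → Pred (Fin N) p} (X? : ∀ d → Decidable (X d)) where

    ∑-count-disjoint : (∀ {d d′ x} → X d x → X d′ x → d ≡ d′) → ∑[ d < s ] count (X? d) ≤ N
    ∑-count-disjoint disjoint = begin
      ∑[ d < s ] count (X? d)          ≡⟨ ∑-comm (λ d x → indicator (X? d x)) ⟩
      ∑[ x < N ] count (λ d → X? d x)  ≤⟨ ∑-mono-≤ (λ x → unique⇒count≤1 (flip X? x) disjoint) ⟩
      ∑[ x < N ] 1                     ≡⟨ ∑-ones N ⟩
      N                                ∎
      where open ≤-Reasoning

    ∑-count-cover : (∀ x → ∃ λ d → X d x) → N ≤ ∑[ d < s ] count (X? d)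
    ∑-count-cover cover = begin
      N                                ≡⟨ ∑-ones N ⟨
      ∑[ x < N ] 1                     ≤⟨ ∑-mono-≤ (λ x → ∃⇒0<count (flip X? x) (proj₂ (cover x))) ⟩
      ∑[ x < N ] count (λ d → X? d x)  ≡⟨ ∑-comm (λ d x → indicator (X? d x)) ⟨
      ∑[ d < s ] count (X? d)          ∎
      where open ≤-Reasoning

module _ {a p : Level} {A : Set a} where

  select : (xs : List A) {P : Pred (Fin (length xs)) p} → Decidable P → List A
  select xs P? = map (lookup xs) (filter P? (allFin (length xs)))

  length-filter-tabulate : ∀ {j k} {P : Pred (Fin k) p} (P? : Decidable P) (g : Fin j → Fin k) →
                           length (filter P? (tabulate g)) ≡ ∑[ i < j ] indicator (P? (g i))
  length-filter-tabulate {zero}  P? g = ≡.refl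
  length-filter-tabulate {suc j} P? g with P? (g zero)
  ... | yes _ = ≡.cong suc (length-filter-tabulate P? (g ∘ suc))
  ... | no  _ = length-filter-tabulate P? (g ∘ suc)

  length-select : (xs : List A) {P : Pred (Fin (length xs)) p} (P? : Decidable P) →
                  length (select xs P?) ≡ count P?
  length-select xs P? = ≡.trans (length-map (lookup xs) (filter P? (allFin _))) (length-filter-tabulate P? id)

  module _ (xs : List A) {P : Pred (Fin (length xs)) p} (P? : Decidable P) {q} {Q : Pred A q} where

    Any-select⁺ : ∀ {i} → P i → Q (lookup xs i) → Any Q (select xs P?)
    Any-select⁺ {i} Pi Qi = AnyP.map⁺ (lose (∈-filter⁺ P? (∈-allFin i) Pi) Qi)

    Any-select⁻ : Any Q (select xs P?) → ∃ λ i → P i × Q (lookup xs i)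
    Any-select⁻ any with i , i∈ , Qi ← find (AnyP.map⁻ any) =
      i , proj₂ (∈-filter⁻ P? {xs = allFin _} i∈) , Qi

    All-select⁺ : (∀ {i} → P i → Q (lookup xs i)) → All Q (select xs P?)
    All-select⁺ f = AllP.map⁺ (All.map f (AllP.all-filter P? (allFin _)))

module _ {a ℓ} (S : Setoid a ℓ) where
  open Setoid S using (_≈_) renaming (sym to ≈-sym)

  lookup-injective : ∀ {xs} → Unique S xs → ∀ {i j} → lookup xs i ≈ lookup xs j → i ≡ j
  lookup-injective (_ ∷ _)    {zero}  {zero}  _  = ≡.refl
  lookup-injective (x≉xs ∷ _) {zero}  {suc j} eq = contradiction eq (All.lookup x≉xs (∈-lookup j))
  lookup-injective (x≉xs ∷ _) {suc i} {zero}  eq = contradiction (≈-sym eq) (All.lookup x≉xs (∈-lookup i))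
  lookup-injective (_ ∷ xs!)  {suc i} {suc j} eq = ≡.cong suc (lookup-injective xs! eq)

  Unique-select⁺ : ∀ {p xs} {P : Pred (Fin (length xs)) p} (P? : Decidable P) →
                   Unique S xs → Unique S (select xs P?)
  Unique-select⁺ {xs = xs} P? xs! = UniqueS.map⁺ (≡.setoid (Fin _)) S (lookup-injective xs!)
    (UniqueS.filter⁺ (≡.setoid (Fin (length xs))) P? (allFin⁺ (length xs)))

-- Labellings and their refinement

Labelling : ℕ → Set
Labelling k = Fin k → Fin k

weight : ∀ {k} → Labelling k → ℕ
weight lab = ∑[ i < _ ] toℕ (lab i)

Sound : ∀ {k ℓ} → Rel (Fin k) ℓ → Labelling k → Set ℓ
Sound _~_ lab = ∀ {i j} → lab i ≡ lab j → i ~ j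

redirect : ∀ {k} (from to : Fin k) → Fin k → Fin k
redirect from to c with c ≟ from
... | yes _ = to
... | no  _ = c

weight-redirect : ∀ {k} (lab : Labelling k) {x y} → toℕ (lab x) < toℕ (lab y) →
                  weight (redirect (lab y) (lab x) ∘ lab) < weight lab
weight-redirect lab {x} {y} x<y = ∑-mono-< lowered y (strict ≡.refl)
  where
  lowered : ∀ i → toℕ (redirect (lab y) (lab x) (lab i)) ≤ toℕ (lab i)
  lowered i with lab i ≟ lab y
  ... | yes i↦y = <⇒≤ (≡.subst (λ c → toℕ (lab x) < toℕ c) (≡.sym i↦y) x<y)
  ... | no  _   = ≤-refl
  strict : ∀ {i} → lab i ≡ lab y → toℕ (redirect (lab y) (lab x) (lab i)) < toℕ (lab i)
  strict {i} i↦y with lab i ≟ lab y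
  ... | yes _   = ≡.subst (λ c → toℕ (lab x) < toℕ c) (≡.sym i↦y) x<y
  ... | no  i↛y = contradiction i↦y i↛y

module _ {k ℓ} {_~_ : Rel (Fin k) ℓ} (~-equiv : IsEquivalence _~_) where
  open IsEquivalence ~-equiv

  sound-id : Sound _~_ id
  sound-id ≡.refl = refl

  sound-redirect : ∀ {lab x y} → Sound _~_ lab → x ~ y → Sound _~_ (redirect (lab y) (lab x) ∘ lab)
  sound-redirect {lab} {x} {y} sound x~y {i} {j} eq with lab i ≟ lab y | lab j ≟ lab y
  ... | yes i↦y | yes j↦y = sound (≡.trans i↦y (≡.sym j↦y))
  ... | yes i↦y | no  _   = trans (sound i↦y) (trans (sym x~y) (sound eq))
  ... | no  _   | yes j↦y = trans (sound eq) (trans x~y (sound (≡.sym j↦y)))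
  ... | no  _   | no  _   = sound eq

  merge : ∀ {lab x y} → Sound _~_ lab → x ~ y → lab x ≢ lab y →
          ∃ λ lab′ → Sound _~_ lab′ × weight lab′ < weight lab
  merge {lab} {x} {y} sound x~y x≁y with <-cmp (lab x) (lab y)
  ... | tri< x<y _ _ = _ , sound-redirect sound x~y , weight-redirect lab {x} {y} x<y
  ... | tri≈ _ x≡y _ = contradiction x≡y x≁y
  ... | tri> _ _ y<x = _ , sound-redirect sound (sym x~y) , weight-redirect lab {y} {x} y<x

module _ {k l u N : ℕ} where

  Closed : (Fin k → Fin l → Fin u → Fin N) → Labelling k → Labelling l → Set
  Closed σ labA labB =
    ∀ {i i′ j j′ t t′} → labA i ≡ labA i′ → σ i j t ≡ σ i′ j′ t′ → labB j ≡ labB j′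

  Violation : (Fin k → Fin l → Fin u → Fin N) → Labelling k → Labelling l → Set
  Violation σ labA labB = ∃₂ λ j j′ → labB j ≢ labB j′ ×
    ∃₂ λ i i′ → ∃₂ λ t t′ → labA i ≡ labA i′ × σ i j t ≡ σ i′ j′ t′

  closed-or-violation : ∀ σ labA labB → Closed σ labA labB ⊎ Violation σ labA labB
  closed-or-violation σ labA labB with violation?
    where
    violation? : Dec (Violation σ labA labB)
    violation? = any? λ j → any? λ j′ → ¬? (labB j ≟ labB j′) ×-dec
                 any? λ i → any? λ i′ → any? λ t → any? λ t′ →
                 (labA i ≟ labA i′) ×-dec (σ i j t ≟ σ i′ j′ t′)
  ... | yes violation = inj₂ violation
  ... | no  closed    = inj₁ λ {i i′ j j′ t t′} A≡ collision →
        decidable-stable (labB j ≟ labB j′) λ B≢ →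
        closed (j , j′ , B≢ , i , i′ , t , t′ , A≡ , collision)

module _ {k l u N : ℕ} (σ : Fin k → Fin l → Fin u → Fin N)
         {ℓa ℓb : Level} {_~A_ : Rel (Fin k) ℓa} {_~B_ : Rel (Fin l) ℓb}
         (~A-equiv : IsEquivalence _~A_) (~B-equiv : IsEquivalence _~B_)
         (transferAB : ∀ {i i′ j j′ t t′} → i ~A i′ → σ i j t ≡ σ i′ j′ t′ → j ~B j′)
         (transferBA : ∀ {i i′ j j′ t t′} → j ~B j′ → σ i j t ≡ σ i′ j′ t′ → i ~A i′)
  where

  record ClosedLabellings : Set (ℓa ⊔ ℓb) where
    field
      labA     : Labelling k
      labB     : Labelling l
      soundA   : Sound _~A_ labA
      soundB   : Sound _~B_ labB
      closedAB : Closed σ labA labB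
      closedBA : Closed (flip σ) labB labA

  -- Each merge lowers the total weight, so the weight bounds the number of rounds.
  refine : ∀ fuel labA labB → Sound _~A_ labA → Sound _~B_ labB →
           weight labA + weight labB < fuel → ClosedLabellings
  refine (suc fuel) labA labB soundA soundB w<fuel with closed-or-violation σ labA labB
  ... | inj₂ (j , j′ , B≢ , i , i′ , t , t′ , A≡ , collision)
      with labB′ , soundB′ , lighter ← merge ~B-equiv soundB (transferAB (soundA A≡) collision) B≢
      = refine fuel labA labB′ soundA soundB′
          (<-≤-trans (+-monoʳ-< (weight labA) lighter) (s≤s⁻¹ w<fuel))
  ... | inj₁ closedAB with closed-or-violation (flip σ) labB labA
  ...   | inj₂ (i , i′ , A≢ , j , j′ , t , t′ , B≡ , collision)
        with labA′ , soundA′ , lighter ← merge ~A-equiv soundA (transferBA (soundB B≡) collision) A≢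
        = refine fuel labA′ labB soundA′ soundB
            (<-≤-trans (+-monoˡ-< (weight labB) lighter) (s≤s⁻¹ w<fuel))
  ...   | inj₁ closedBA = record
    { labA = labA ; labB = labB ; soundA = soundA ; soundB = soundB
    ; closedAB = closedAB ; closedBA = closedBA }

  closedLabellings : ClosedLabellings
  closedLabellings = refine _ id id (sound-id ~A-equiv) (sound-id ~B-equiv) ≤-refl

Class : ∀ {r} → Labelling r → Fin r → Pred (Fin r) _
Class lab c i = lab i ≡ c

class? : ∀ {r} (lab : Labelling r) (c : Fin r) → Decidable (Class lab c)
class? lab c i = lab i ≟ c

size : ∀ {r} → Labelling r → Fin r → ℕ
size lab c = count (class? lab c)

∑-size : ∀ {r} (lab : Labelling r) → r ≤ ∑[ c < r ] size lab c
∑-size lab = ∑-count-cover (class? lab) (λ i → lab i , ≡.refl)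

module _ {k l u N : ℕ} (σ : Fin k → Fin l → Fin u → Fin N) where

  Hit : ∀ {p q} → Pred (Fin k) p → Pred (Fin l) q → Pred (Fin N) (p ⊔ q)
  Hit I J x = ∃₂ λ i j → ∃ λ t → I i × J j × σ i j t ≡ x

  hit? : ∀ {p q} {I : Pred (Fin k) p} {J : Pred (Fin l) q} →
         Decidable I → Decidable J → Decidable (Hit I J)
  hit? I? J? x = any? λ i → any? λ j → any? λ t → I? i ×-dec J? j ×-dec (σ i j t ≟ x)

  module _ (labA : Labelling k) (labB : Labelling l) where

    hits : Fin k → Fin l → ℕ
    hits c d = count (hit? (class? labA c) (class? labB d))

    ∑-hits-row : Closed σ labA labB → ∀ c → ∑[ d < l ] hits c d ≤ N
    ∑-hits-row closed c = ∑-count-disjoint (λ d → hit? (class? labA c) (class? labB d)) disjoint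
      where
      disjoint : ∀ {d d′ x} → Hit (Class labA c) (Class labB d) x → Hit (Class labA c) (Class labB d′) x →
                 d ≡ d′
      disjoint (i , j , t , ≡.refl , ≡.refl , ≡.refl) (i′ , j′ , t′ , A≡ , ≡.refl , collision) =
        closed (≡.sym A≡) (≡.sym collision)

    ∑-hits-column : Closed (flip σ) labB labA → ∀ d → ∑[ c < k ] hits c d ≤ N
    ∑-hits-column closed d = ∑-count-disjoint (λ c → hit? (class? labA c) (class? labB d)) disjoint
      where
      disjoint : ∀ {c c′ x} → Hit (Class labA c) (Class labB d) x → Hit (Class labA c′) (Class labB d) x →
                 c ≡ c′
      disjoint (i , j , t , ≡.refl , ≡.refl , ≡.refl) (i′ , j′ , t′ , ≡.refl , B≡ , collision) =
        closed (≡.sym B≡) (≡.sym collision)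

    good-class-pair : ∀ m n → Closed σ labA labB → Closed (flip σ) labB labA →
                      n * n * (N * N) < m * m * (k * l) →
                      ∃₂ λ c d → n * n * (hits c d * hits c d) < m * m * (size labA c * size labB d)
    good-class-pair m n closedAB closedBA below
      with any? (λ c → any? λ d → n * n * (hits c d * hits c d) <? m * m * (size labA c * size labB d))
    ... | yes good = good
    ... | no  none = contradiction below (≤⇒≯ bound)
      where
      bound : m * m * (k * l) ≤ n * n * (N * N)
      bound = ≤-trans (*-monoʳ-≤ (m * m) (*-mono-≤ (∑-size labA) (∑-size labB)))
                (grid-bound m n N (size labA) (size labB) hits
                   (∑-hits-row closedAB) (∑-hits-column closedBA) λ c d → ≮⇒≥ λ better → none (c , d , better))

-- Cosets and sumsets

module _ {c ℓ p : Level} (G : AbelianGroup c ℓ) {P : AbelianGroup.Carrier G → Set p} (H : IsSubgroup G P) where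
  open AbelianGroup G
  open IsSubgroup H
  open import Algebra.Properties.AbelianGroup G
    using (⁻¹-anti-homo‿-; ⁻¹-∙-comm; x≈y⇒x∙y⁻¹≈ε; inverseˡ-unique; ∙-cancelʳ)
  open import Algebra.Properties.CommutativeSemigroup commutativeSemigroup using (interchange)
  open import Algebra.Solver.CommutativeMonoid commutativeMonoid using (solve; _⊜_; _⊕_)
  open import Relation.Binary.Reasoning.Setoid setoid

  infix 4 _∈_ _∼_

  _∈_ : Carrier → List Carrier → Set (c ⊔ ℓ)
  _∈_ = _∈≈_ G

  InSumset : List Carrier → List Carrier → List Carrier → Carrier → Set (c ⊔ ℓ)
  InSumset A B U x = ∃ λ a → ∃ λ b → ∃ λ u → a ∈ A × b ∈ B × u ∈ U × x ≈ (a ∙ b) ∙ u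

  _∼_ : Rel Carrier p
  x ∼ y = P (x - y)

  -‿interchange : ∀ x y x′ y′ → (x ∙ y) - (x′ ∙ y′) ≈ (x - x′) ∙ (y - y′)
  -‿interchange x y x′ y′ =
    trans (∙-congˡ (sym (⁻¹-∙-comm x′ y′))) (interchange x y (x′ ⁻¹) (y′ ⁻¹))

  ∼-isEquivalence : IsEquivalence _∼_
  ∼-isEquivalence = record
    { refl  = λ {x} → resp (sym (inverseʳ x)) ε-mem
    ; sym   = λ {x} {y} x∼y → resp (⁻¹-anti-homo‿- x y) (⁻¹-mem x∼y)
    ; trans = λ {x} {y} {z} x∼y y∼z → resp (telescope x y z) (∙-mem x∼y y∼z)
    }
    where
    telescope : ∀ x y z → (x - y) ∙ (y - z) ≈ x - z
    telescope x y z = begin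
      (x - y) ∙ (y - z)     ≈⟨ solve 4 (λ x y y⁻ z⁻ → (x ⊕ y⁻) ⊕ (y ⊕ z⁻) ⊜ (x ⊕ z⁻) ⊕ (y⁻ ⊕ y))
                                 refl x y (y ⁻¹) (z ⁻¹) ⟩
      (x - z) ∙ (y ⁻¹ ∙ y)  ≈⟨ ∙-congˡ (inverseˡ y) ⟩
      (x - z) ∙ ε           ≈⟨ identityʳ _ ⟩
      x - z                 ∎

  ∼-cancel : ∀ {a b u a′ b′ u′} → a ∙ b ∙ u ≈ a′ ∙ b′ ∙ u′ → a ∼ a′ → u ∼ u′ → b ∼ b′
  ∼-cancel {a} {b} {u} {a′} {b′} {u′} eq a∼a′ u∼u′ =
    resp (sym (inverseˡ-unique _ _ differences)) (⁻¹-mem (∙-mem a∼a′ u∼u′))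
    where
    differences : (b - b′) ∙ ((a - a′) ∙ (u - u′)) ≈ ε
    differences = begin
      (b - b′) ∙ ((a - a′) ∙ (u - u′))  ≈⟨ solve 3 (λ x y z → y ⊕ (x ⊕ z) ⊜ (x ⊕ y) ⊕ z)
                                                   refl (a - a′) (b - b′) (u - u′) ⟩
      (a - a′) ∙ (b - b′) ∙ (u - u′)    ≈⟨ ∙-congʳ (-‿interchange a b a′ b′) ⟨
      (a ∙ b - a′ ∙ b′) ∙ (u - u′)      ≈⟨ -‿interchange (a ∙ b) u (a′ ∙ b′) u′ ⟨
      a ∙ b ∙ u - a′ ∙ b′ ∙ u′          ≈⟨ x≈y⇒x∙y⁻¹≈ε eq ⟩
      ε                                 ∎

  ∈⇒∼ : ∀ {x y} → P x → P y → x ∼ y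
  ∈⇒∼ Px Py = ∙-mem Px (⁻¹-mem Py)

  Distinct-translate : ∀ {xs} g → Distinct G xs → Distinct G (map (_∙ g) xs)
  Distinct-translate g = UniqueS.map⁺ setoid setoid (∙-cancelʳ g _ _)

  ∈-translate⁺ : ∀ {x xs} g → x ∈ xs → x ∙ g ∈ map (_∙ g) xs
  ∈-translate⁺ g = ∈S.∈-map⁺ setoid setoid ∙-congʳ

  ∈-translate⁻ : ∀ {y xs} g → y ∈ map (_∙ g) xs → ∃ λ x → x ∈ xs × y ≈ x ∙ g
  ∈-translate⁻ g = ∈S.∈-map⁻ setoid setoid

  IsSumset-translate : ∀ {A B U C} g h → IsSumset G A B U C →
                       IsSumset G (map (_∙ g) A) (map (_∙ h) B) U (map (_∙ (g ∙ h)) C)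
  IsSumset-translate {A} {B} {U} {C} g h (C! , C≡A+B+U) =
    Distinct-translate (g ∙ h) C! , λ x → mk⇔ (to x) (from x)
    where
    shuffle : ∀ a b u → (a ∙ g) ∙ (b ∙ h) ∙ u ≈ (a ∙ b ∙ u) ∙ (g ∙ h)
    shuffle a b u =
      solve 5 (λ a b u g h → ((a ⊕ g) ⊕ (b ⊕ h)) ⊕ u ⊜ ((a ⊕ b) ⊕ u) ⊕ (g ⊕ h)) refl a b u g h
    to : ∀ x → x ∈ map (_∙ (g ∙ h)) C → InSumset (map (_∙ g) A) (map (_∙ h) B) U x
    to x x∈ with y , y∈C , x≈ ← ∈-translate⁻ (g ∙ h) x∈
         with a , b , u , a∈ , b∈ , u∈ , y≈ ← Equivalence.to (C≡A+B+U y) y∈C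
         = a ∙ g , b ∙ h , u , ∈-translate⁺ g a∈ , ∈-translate⁺ h b∈ , u∈ ,
           trans x≈ (trans (∙-congʳ y≈) (sym (shuffle a b u)))
    from : ∀ x → InSumset (map (_∙ g) A) (map (_∙ h) B) U x → x ∈ map (_∙ (g ∙ h)) C
    from x (a′ , b′ , u , a′∈ , b′∈ , u∈ , x≈)
      with a , a∈ , a′≈ ← ∈-translate⁻ g a′∈
      with b , b∈ , b′≈ ← ∈-translate⁻ h b′∈
      = Any.map (trans (trans x≈ (trans (∙-congʳ (∙-cong a′≈ b′≈)) (shuffle a b u))))
          (∈-translate⁺ (g ∙ h) (Equivalence.from (C≡A+B+U _) (a , b , u , a∈ , b∈ , u∈ , refl)))

  module _ {A B U C : List Carrier} (sumset : IsSumset G A B U C) where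

    private
      ∈-sumset : ∀ i j t → lookup A i ∙ lookup B j ∙ lookup U t ∈ C
      ∈-sumset i j t = Equivalence.from (proj₂ sumset _)
        (_ , _ , _ , ∈S.∈-lookup setoid A i , ∈S.∈-lookup setoid B j , ∈S.∈-lookup setoid U t , refl)

    sum-index : Fin (length A) → Fin (length B) → Fin (length U) → Fin (length C)
    sum-index i j t = Any.index (∈-sumset i j t)

    sum-index-correct : ∀ i j t → lookup A i ∙ lookup B j ∙ lookup U t ≈ lookup C (sum-index i j t)
    sum-index-correct i j t = AnyP.lookup-index (∈-sumset i j t)

    sum-index-collision : ∀ {i i′ j j′ t t′} → sum-index i j t ≡ sum-index i′ j′ t′ →
                          lookup A i ∙ lookup B j ∙ lookup U t ≈
                          lookup A i′ ∙ lookup B j′ ∙ lookup U t′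
    sum-index-collision {i} {i′} {j} {j′} {t} {t′} collision =
      begin
        lookup A i ∙ lookup B j ∙ lookup U t        ≈⟨ sum-index-correct i j t ⟩
        lookup C (sum-index i j t)                  ≡⟨ ≡.cong (lookup C) collision ⟩
        lookup C (sum-index i′ j′ t′)               ≈⟨ sum-index-correct i′ j′ t′ ⟨
        lookup A i′ ∙ lookup B j′ ∙ lookup U t′     ∎

  IsSumset-restrict : ∀ {A B U C} (sumset : IsSumset G A B U C) {q r}
                      {I : Pred (Fin (length A)) q} (I? : Decidable I)
                      {J : Pred (Fin (length B)) r} (J? : Decidable J) →
                      IsSumset G (select A I?) (select B J?) U (select C (hit? (sum-index sumset) I? J?))
  IsSumset-restrict {A} {B} {U} {C} sumset@(C! , _) {I = I} I? {J = J} J? =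
    Unique-select⁺ setoid _ C! , λ x → mk⇔ (to x) (from x)
    where
    σ : Fin (length A) → Fin (length B) → Fin (length U) → Fin (length C)
    σ = sum-index sumset
    K? : Decidable (Hit σ I J)
    K? = hit? σ I? J?
    to : ∀ x → x ∈ select C K? → InSumset (select A I?) (select B J?) U x
    to x x∈ with _ , (i , j , t , Ii , Jj , ≡.refl) , x≈ ← Any-select⁻ C K? x∈
      = lookup A i , lookup B j , lookup U t ,
        Any-select⁺ A I? Ii refl , Any-select⁺ B J? Jj refl , ∈S.∈-lookup setoid U t ,
        trans x≈ (sym (sum-index-correct sumset i j t))
    from : ∀ x → InSumset (select A I?) (select B J?) U x → x ∈ select C K?
    from x (a , b , u , a∈ , b∈ , u∈ , x≈)
      with i , Ii , a≈ ← Any-select⁻ A I? a∈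
      with j , Jj , b≈ ← Any-select⁻ B J? b∈
      = Any-select⁺ C K? (i , j , t , Ii , Jj , ≡.refl)
          (trans x≈ (trans (∙-cong (∙-cong a≈ b≈) (AnyP.lookup-index u∈))
                           (sum-index-correct sumset i j t)))
      where
      t : Fin (length U)
      t = Any.index u∈

  length-translate-select : ∀ g xs {q} {Q : Pred (Fin (length xs)) q} (Q? : Decidable Q) →
                            length (map (_∙ g) (select xs Q?)) ≡ count Q?
  length-translate-select g xs Q? = ≡.trans (length-map (_∙ g) (select xs Q?)) (length-select xs Q?)

  nonEmpty : ∀ {xs} → 0 < length xs → NonEmpty G xs
  nonEmpty {_ ∷ _} _ ()

  module _ {U : List Carrier} (U⊆H : All P U) {A B C : List Carrier}
           (A! : Distinct G A) (B! : Distinct G B) (sumset : IsSumset G A B U C) where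

    private
      σ : Fin (length A) → Fin (length B) → Fin (length U) → Fin (length C)
      σ = sum-index sumset

      U-coset : ∀ t t′ → lookup U t ∼ lookup U t′
      U-coset t t′ = ∈⇒∼ (All.lookup U⊆H (∈-lookup t)) (All.lookup U⊆H (∈-lookup t′))

      transferAB : ∀ {i i′ j j′ t t′} → lookup A i ∼ lookup A i′ → σ i j t ≡ σ i′ j′ t′ →
                   lookup B j ∼ lookup B j′
      transferAB {t = t} {t′} a∼a′ collision =
        ∼-cancel (sum-index-collision sumset collision) a∼a′ (U-coset t t′)

      transferBA : ∀ {i i′ j j′ t t′} → lookup B j ∼ lookup B j′ → σ i j t ≡ σ i′ j′ t′ →
                   lookup A i ∼ lookup A i′
      transferBA {i} {i′} {j} {j′} {t} {t′} b∼b′ collision =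
        ∼-cancel swapped b∼b′ (U-coset t t′)
        where
        swapped : lookup B j ∙ lookup A i ∙ lookup U t ≈ lookup B j′ ∙ lookup A i′ ∙ lookup U t′
        swapped = trans (∙-congʳ (comm _ _)) (trans (sum-index-collision sumset collision) (∙-congʳ (comm _ _)))

    open ClosedLabellings (closedLabellings σ (On.isEquivalence (lookup A) ∼-isEquivalence)
                                              (On.isEquivalence (lookup B) ∼-isEquivalence) transferAB transferBA)

    βBelow-from-classes : ∀ m n c d →
      n * n * (hits σ labA labB c d * hits σ labA labB c d) < m * m * (size labA c * size labB d) →
      βBelow G P U m n
    βBelow-from-classes m n c d below =
      A′ , B′ , C′ , A′⊆H , B′⊆H ,
      Distinct-translate α (Unique-select⁺ setoid I? A!) , Distinct-translate β (Unique-select⁺ setoid J? B!) ,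
      nonEmpty (≡.subst (0 <_) (≡.sym |A′|) (proj₁ positive)) ,
      nonEmpty (≡.subst (0 <_) (≡.sym |B′|) (proj₂ positive)) ,
      IsSumset-translate α β (IsSumset-restrict sumset I? J?) ,
      ≡.subst₂ (λ x y → n * n * (x * x) < m * m * y) (≡.sym |C′|) (≡.sym (≡.cong₂ _*_ |A′| |B′|))
               below
      where
      I? : Decidable (Class labA c)
      I? = class? labA c
      J? : Decidable (Class labB d)
      J? = class? labB d
      K? : Decidable (Hit σ (Class labA c) (Class labB d))
      K? = hit? σ I? J?
      positive : 0 < size labA c × 0 < size labB d
      positive = positive-factors (m * m) (≤-<-trans z≤n below)
      a₀ : ∃ (Class labA c)
      a₀ = 0<count⇒∃ I? (proj₁ positive)
      b₀ : ∃ (Class labB d)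
      b₀ = 0<count⇒∃ J? (proj₂ positive)
      α β : Carrier
      α = lookup A (proj₁ a₀) ⁻¹
      β = lookup B (proj₁ b₀) ⁻¹
      A′ B′ C′ : List Carrier
      A′ = map (_∙ α) (select A I?)
      B′ = map (_∙ β) (select B J?)
      C′ = map (_∙ (α ∙ β)) (select C K?)
      |A′| : length A′ ≡ size labA c
      |A′| = length-translate-select α A I?
      |B′| : length B′ ≡ size labB d
      |B′| = length-translate-select β B J?
      |C′| : length C′ ≡ hits σ labA labB c d
      |C′| = length-translate-select (α ∙ β) C K?
      A′⊆H : All P A′
      A′⊆H = AllP.map⁺ (All-select⁺ A I? λ i∈c → soundA (≡.trans i∈c (≡.sym (proj₂ a₀))))
      B′⊆H : All P B′
      B′⊆H = AllP.map⁺ (All-select⁺ B J? λ j∈d → soundB (≡.trans j∈d (≡.sym (proj₂ b₀))))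

    βBelow-restrict : ∀ m n → n * n * (length C * length C) < m * m * (length A * length B) →
                      βBelow G P U m n
    βBelow-restrict m n below =
      let c , d , better = good-class-pair σ labA labB m n closedAB closedBA below
      in  βBelow-from-classes m n c d better

  βBelow-subgroup : ∀ {U} → All P U → ∀ m n → βBelow G (λ _ → ⊤ {0ℓ}) U m n → βBelow G P U m n
  βBelow-subgroup U⊆H m n (_ , _ , _ , _ , _ , A! , B! , _ , _ , sumset , below) =
    βBelow-restrict U⊆H A! B! sumset m n below

βBelow-forget : ∀ {c ℓ p q} (G : AbelianGroup c ℓ) {P : AbelianGroup.Carrier G → Set p} →
                ∀ {U} m n → βBelow G P U m n → βBelow G (λ _ → ⊤ {q}) U m n
βBelow-forget G m n (A , B , C , _ , _ , rest) = A , B , C , All.universal _ A , All.universal _ B , rest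

mainTheorem5 : {c ℓ p : Level} (G : AbelianGroup c ℓ)
    → (P : AbelianGroup.Carrier G → Set p) → IsSubgroup G P
    → (U : List (AbelianGroup.Carrier G)) → All P U
    → (m n : ℕ)
    → βBelow G (λ _ → ⊤ {0ℓ}) U m (suc n) ⇔ βBelow G P U m (suc n)
mainTheorem5 G P H U U⊆H m n = mk⇔ (βBelow-subgroup G H U⊆H m (suc n)) (βBelow-forget G m (suc n))
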